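{- Let $\vec b=(b_0,b_1,\dots)$ be an infinite sequence of integers. For every integer $n\ge1$, $\widehat{C}^{\vec b}_{3,2,n}=\widehat{C}^{\vec b}_{3,3,n}=b_0^n$.
   Context: A $k$-dimensional balanced ballot path of length $kn$ is a sequence of $kn$ standard unit vectors of $\mathbb{R}^k$, each $\vec e_i$ occurring exactly $n$ times, such that every intermediate point (partial sum) $\vec x=(x_1,\dots,x_k)$ satisfies $x_1\ge\cdots\ge x_k$. The semisymmetric height of $\vec x$ is $g_k(\vec x)=\sum_{i=1}^k(k+1-2i)x_i$ and the semisymmetric height $g_k(P)$ of a path is the maximum of $g_k$ over its intermediate points. Steps $\vec e_i$ with $i\le\lfloor k/2\rfloor$ are semisymmetric up-steps. For a sequence $\vec b$, the weight $sswt_{\vec b}(P)$ is the product, over all up-steps of $P$, of $b_h$ where $h$ is the semisymmetric height of the starting point of that up-step. Define $\widehat{C}^{\vec b}_{k,u,n}=\sum_P sswt_{\vec b}(P)$, summed over all $k$-dimensional balanced ballot paths of length $kn$ with $g_k(P)\le u$. -}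

module Defs where

open import Data.Bool using (Bool; true; false; _∧_; if_then_else_)
open import Data.Nat as ℕ using (ℕ; zero; suc; _≡ᵇ_; _<ᵇ_; _/_)
open import Data.Integer as ℤ using (ℤ; +_; ∣_∣)
open import Data.Fin using (Fin; toℕ; _≟_)
open import Data.List using (List; []; _∷_; map; concatMap; allFin; filter; foldr; length)
open import Data.Bool.ListAction using (and)
open import Relation.Nullary.Decidable using (does)
open import Data.Bool.Properties using (T?)

-- A lattice point in ℕ^k, coordinates indexed by Fin k (coordinate i ↦ x_{i+1}).
Point : ℕ → Set
Point k = Fin k → ℕ

origin : ∀ {k} → Point k
origin _ = 0

step : ∀ {k} → Point k → Fin k → Point k
step x i j = if does (i ≟ j) then suc (x j) else x j

-- A path of length m is a word over Fin k (the indices of its unit steps).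
Path : ℕ → Set
Path k = List (Fin k)

words : (k m : ℕ) → List (Path k)
words k zero = [] ∷ []
words k (suc m) = concatMap (λ i → map (i ∷_) (words k m)) (allFin k)

points : ∀ {k} → Point k → Path k → List (Point k)
points x [] = x ∷ []
points x (i ∷ p) = x ∷ points (step x i) p

count : ∀ {k} → Fin k → Path k → ℕ
count i [] = 0
count i (j ∷ p) = if does (i ≟ j) then suc (count i p) else count i p

balancedᵇ : ∀ {k} → ℕ → Path k → Bool
balancedᵇ {k} n p = and (map (λ i → count i p ≡ᵇ n) (allFin k))

weaklyDecᵇ : ∀ {k} → Point k → Bool
weaklyDecᵇ {k} x =
  and (concatMap (λ i → map (λ j → if toℕ i <ᵇ toℕ j then x j ℕ.≤ᵇ x i else true) (allFin k)) (allFin k))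

ballotᵇ : ∀ {k} → Path k → Bool
ballotᵇ p = and (map weaklyDecᵇ (points origin p))

sumℤ : List ℤ → ℤ
sumℤ = foldr ℤ._+_ (+ 0)

g : ∀ {k} → Point k → ℤ
g {k} x = sumℤ (map (λ i → (+ (suc k) ℤ.- + (2 ℕ.* suc (toℕ i))) ℤ.* + (x i)) (allFin k))

-- semisymmetric height of a path: maximum of g over its points (the origin is one of them)
heightP : ∀ {k} → Path k → ℤ
heightP {k} p = foldr ℤ._⊔_ (g {k} origin) (map g (points origin p))

-- e_i (1-based index i) is a semisymmetric up-step iff i ≤ ⌊k/2⌋
isUpᵇ : ∀ {k} → Fin k → Bool
isUpᵇ {k} i = toℕ i <ᵇ (k / 2)

-- weight: product over up-steps of b_h, h = semisymmetric height of the starting point.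
-- (On ballot points g ≥ 0, so ∣ g x ∣ = g x.)
sswtFrom : ∀ {k} → (ℕ → ℤ) → Point k → Path k → ℤ
sswtFrom b x [] = + 1
sswtFrom b x (i ∷ p) =
  (if isUpᵇ i then b ∣ g x ∣ else + 1) ℤ.* sswtFrom b (step x i) p

sswt : ∀ {k} → (ℕ → ℤ) → Path k → ℤ
sswt b p = sswtFrom b origin p

Chat : (b : ℕ → ℤ) (k : ℕ) (u : ℤ) (n : ℕ) → ℤ
Chat b k u n =
  sumℤ (map (sswt b)
    (filter (λ p → T? (balancedᵇ n p ∧ ballotᵇ p ∧ (heightP p ℤ.≤ᵇ u)))
      (words k (k ℕ.* n))))

module Submission where

open import Defs
open import Data.Nat using (ℕ; _≤_)
open import Data.Integer using (ℤ; +_; _^_)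
open import Data.Product using (_×_)
open import Relation.Binary.PropositionalEquality using (_≡_)

open import Data.Bool using (Bool; true; false; _∧_; if_then_else_)
open import Data.Bool.ListAction using (and; all)
open import Data.Bool.Properties using (∧-assoc; ∧-comm; ∧-zeroʳ; ∧-identityʳ)
open import Data.Fin using (Fin; zero; suc; _≟_)
open import Data.Fin.Properties using (suc-injective)
open import Data.Integer as ℤ using (∣_∣; _+_; _*_; _-_; _⊔_; _≤ᵇ_)
open import Data.Integer.Properties as ℤ using (pos-+; pos-*)
open import Data.Integer.Solver using (module +-*-Solver)
open import Data.List using (List; []; _∷_; _++_; map; concatMap; filter; foldr; tabulate; allFin)
open import Data.List.Properties using (map-cong; map-tabulate)
open import Data.Nat as ℕ using (suc; _≡ᵇ_; _≤?_)
open import Data.Nat.Properties as ℕ using (≤-refl; n<1+n; n≤1+n; <⇒≱; +-suc; +-identityʳ; *-suc)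
open import Data.Product using (_,_)
open import Function using (_∘_; id)
open import Relation.Binary.PropositionalEquality
  using (_≢_; _≗_; refl; sym; trans; cong; cong₂; module ≡-Reasoning)
open import Relation.Nullary using (¬_; does; yes; no; contradiction)
open import Relation.Nullary.Decidable using (dec-true; dec-false; T?)

-- For k = 3 only e₁ is an up-step and g(x) = 2(x₁ − x₃), so a height bound u ∈ {2, 3}
-- means x₁ − x₃ ≤ 1 all along the path.  Together with x₁ ≥ x₂ ≥ x₃ this leaves exactly
-- one admissible step at each point: e₁ from (a,a,a), e₂ from (a+1,a,a) and e₃ from
-- (a+1,a+1,a).  So (e₁e₂e₃)ⁿ is the only path counted, and each of its e₁-steps starts at
-- height 0 and contributes b₀.  The weighted count is evaluated by the transfer recursion
-- that splits off the first step of a path.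

private
  variable
    A B : Set
    k : ℕ

sumWhere : (A → Bool) → (A → ℤ) → List A → ℤ
sumWhere P w []       = + 0
sumWhere P w (x ∷ xs) = if P x then w x + sumWhere P w xs else sumWhere P w xs

module _ (P : A → Bool) (w : A → ℤ) where

  sum-map-filter : ∀ xs → sumℤ (map w (filter (T? ∘ P) xs)) ≡ sumWhere P w xs
  sum-map-filter []       = refl
  sum-map-filter (x ∷ xs) with P x
  ... | true  = cong (λ s → w x + s) (sum-map-filter xs)
  ... | false = sum-map-filter xs

  sumWhere-++ : ∀ xs ys → sumWhere P w (xs ++ ys) ≡ sumWhere P w xs + sumWhere P w ys
  sumWhere-++ []       ys = sym (ℤ.+-identityˡ _)
  sumWhere-++ (x ∷ xs) ys with P x
  ... | true  = trans (cong (λ s → w x + s) (sumWhere-++ xs ys)) (sym (ℤ.+-assoc (w x) _ _))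
  ... | false = sumWhere-++ xs ys

  sumWhere-concatMap : (f : B → List A) → ∀ zs →
    sumWhere P w (concatMap f zs) ≡ sumℤ (map (sumWhere P w ∘ f) zs)
  sumWhere-concatMap f []       = refl
  sumWhere-concatMap f (z ∷ zs) =
    trans (sumWhere-++ (f z) (concatMap f zs))
          (cong (λ s → sumWhere P w (f z) + s) (sumWhere-concatMap f zs))

  sumWhere-map : (f : B → A) → ∀ zs → sumWhere P w (map f zs) ≡ sumWhere (P ∘ f) (w ∘ f) zs
  sumWhere-map f []       = refl
  sumWhere-map f (z ∷ zs) with P (f z)
  ... | true  = cong (λ s → w (f z) + s) (sumWhere-map f zs)
  ... | false = sumWhere-map f zs

  sumWhere-*ˡ : ∀ c xs → sumWhere P (λ x → c * w x) xs ≡ c * sumWhere P w xs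
  sumWhere-*ˡ c []       = sym (ℤ.*-zeroʳ c)
  sumWhere-*ˡ c (x ∷ xs) with P x
  ... | true  = trans (cong (λ s → c * w x + s) (sumWhere-*ˡ c xs)) (sym (ℤ.*-distribˡ-+ c (w x) _))
  ... | false = sumWhere-*ˡ c xs

  sumWhere-none : (∀ x → P x ≡ false) → ∀ xs → sumWhere P w xs ≡ + 0
  sumWhere-none none []       = refl
  sumWhere-none none (x ∷ xs) rewrite none x = sumWhere-none none xs

sumWhere-cong : {P Q : A → Bool} (w : A → ℤ) → P ≗ Q → ∀ xs →
  sumWhere P w xs ≡ sumWhere Q w xs
sumWhere-cong w P≗Q []       = refl
sumWhere-cong w P≗Q (x ∷ xs) rewrite P≗Q x | sumWhere-cong w P≗Q xs = refl

sum-tabulate-zero : (f : Fin k → ℤ) → (∀ j → f j ≡ + 0) → sumℤ (tabulate f) ≡ + 0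
sum-tabulate-zero {ℕ.zero} f f≡0 = refl
sum-tabulate-zero {suc k}  f f≡0 = cong₂ _+_ (f≡0 zero) (sum-tabulate-zero (f ∘ suc) (f≡0 ∘ suc))

sum-tabulate-single : (f : Fin k → ℤ) (i : Fin k) → (∀ j → j ≢ i → f j ≡ + 0) →
  sumℤ (tabulate f) ≡ f i
sum-tabulate-single f zero    off = begin
  f zero + sumℤ (tabulate (f ∘ suc))  ≡⟨ cong (λ s → f zero + s) rest≡0 ⟩
  f zero + + 0                        ≡⟨ ℤ.+-identityʳ (f zero) ⟩
  f zero                              ∎
  where
  open ≡-Reasoning
  rest≡0 : sumℤ (tabulate (f ∘ suc)) ≡ + 0
  rest≡0 = sum-tabulate-zero (f ∘ suc) (λ j → off (suc j) λ ())
sum-tabulate-single f (suc i) off = begin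
  f zero + sumℤ (tabulate (f ∘ suc))  ≡⟨ cong₂ _+_ (off zero λ ()) rest≡fi ⟩
  + 0 + f (suc i)                     ≡⟨ ℤ.+-identityˡ (f (suc i)) ⟩
  f (suc i)                           ∎
  where
  open ≡-Reasoning
  rest≡fi : sumℤ (tabulate (f ∘ suc)) ≡ f (suc i)
  rest≡fi = sum-tabulate-single (f ∘ suc) i (λ j j≢i → off (suc j) (j≢i ∘ suc-injective))

sum-allFin-single : (f : Fin k → ℤ) (i : Fin k) → (∀ j → j ≢ i → f j ≡ + 0) →
  sumℤ (map f (allFin k)) ≡ f i
sum-allFin-single f i off = trans (cong sumℤ (map-tabulate id f)) (sum-tabulate-single f i off)

endpoint : Point k → Path k → Point k
endpoint x []      = x
endpoint x (i ∷ p) = endpoint (step x i) p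

endpoint-count : (x : Point k) (p : Path k) (j : Fin k) → endpoint x p j ≡ x j ℕ.+ count j p
endpoint-count x []      j = sym (+-identityʳ (x j))
endpoint-count x (i ∷ p) j = trans (endpoint-count (step x i) p j) (step-count i (x j) (count j p))
  where
  step-count : ∀ i a c →
    (if does (i ≟ j) then suc a else a) ℕ.+ c ≡ a ℕ.+ (if does (j ≟ i) then suc c else c)
  step-count i a c with i ≟ j | j ≟ i
  ... | yes _   | yes _   = sym (+-suc a c)
  ... | no _    | no _    = refl
  ... | yes i≡j | no j≢i  = contradiction (sym i≡j) j≢i
  ... | no i≢j  | yes j≡i = contradiction (sym j≡i) i≢j

all-∧ : (P Q : A → Bool) → ∀ xs → all (λ x → P x ∧ Q x) xs ≡ all P xs ∧ all Q xs
all-∧ P Q []       = refl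
all-∧ P Q (x ∷ xs) with P x | Q x
... | false | _     = refl
... | true  | false = sym (∧-zeroʳ (all P xs))
... | true  | true  = all-∧ P Q xs

≤ᵇ-true : ∀ {i j} → i ℤ.≤ j → (i ≤ᵇ j) ≡ true
≤ᵇ-true i≤j = dec-true (T? _) (ℤ.≤⇒≤ᵇ i≤j)

≤ᵇ-false : ∀ {i j} → ¬ i ℤ.≤ j → (i ≤ᵇ j) ≡ false
≤ᵇ-false i≰j = dec-false (T? _) (i≰j ∘ ℤ.≤ᵇ⇒≤)

⊔-≤ᵇ : ∀ i j l → (i ⊔ j ≤ᵇ l) ≡ (i ≤ᵇ l) ∧ (j ≤ᵇ l)
⊔-≤ᵇ i j l with i ℤ.≤? l | j ℤ.≤? l
... | yes i≤l | yes j≤l =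
  trans (≤ᵇ-true (ℤ.⊔-lub i≤l j≤l)) (sym (cong₂ _∧_ (≤ᵇ-true i≤l) (≤ᵇ-true j≤l)))
... | no i≰l  | _       =
  trans (≤ᵇ-false (i≰l ∘ ℤ.i⊔j≤k⇒i≤k i j))
        (sym (cong (_∧ (j ≤ᵇ l)) (≤ᵇ-false i≰l)))
... | yes _   | no j≰l  =
  trans (≤ᵇ-false (j≰l ∘ ℤ.i⊔j≤k⇒j≤k i j))
        (sym (trans (cong ((i ≤ᵇ l) ∧_) (≤ᵇ-false j≰l)) (∧-zeroʳ (i ≤ᵇ l))))

foldr-⊔-≤ᵇ : ∀ u (f : A → ℤ) z xs →
  (foldr _⊔_ z (map f xs) ≤ᵇ u) ≡ all (λ x → f x ≤ᵇ u) xs ∧ (z ≤ᵇ u)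
foldr-⊔-≤ᵇ u f z []       = refl
foldr-⊔-≤ᵇ u f z (x ∷ xs) =
  trans (⊔-≤ᵇ (f x) _ u)
        (trans (cong ((f x ≤ᵇ u) ∧_) (foldr-⊔-≤ᵇ u f z xs)) (sym (∧-assoc (f x ≤ᵇ u) _ _)))

heightP-≤ᵇ : ∀ {k} u (p : Path k) →
  (heightP p ≤ᵇ u) ≡ all (λ y → g y ≤ᵇ u) (points origin p)
heightP-≤ᵇ {k} u p = trans (foldr-⊔-≤ᵇ u g (g {k} origin) (points origin p)) (origin-first p)
  where
  absorb : ∀ z r → (z ∧ r) ∧ z ≡ z ∧ r
  absorb true  r = ∧-identityʳ r
  absorb false r = refl

  origin-first : ∀ p → all (λ y → g y ≤ᵇ u) (points origin p) ∧ (g {k} origin ≤ᵇ u)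
                     ≡ all (λ y → g y ≤ᵇ u) (points origin p)
  origin-first []      = absorb (g {k} origin ≤ᵇ u) true
  origin-first (i ∷ p) =
    absorb (g {k} origin ≤ᵇ u) (all (λ y → g y ≤ᵇ u) (points (step origin i) p))

ballotWithin : ℤ → Point k → Bool
ballotWithin u x = weaklyDecᵇ x ∧ (g x ≤ᵇ u)

reaches : ℕ → Point k → Bool
reaches {k} n x = all (λ j → x j ≡ᵇ n) (allFin k)

upFactor : (ℕ → ℤ) → Point k → Fin k → ℤ
upFactor b x i = if isUpᵇ i then b ∣ g x ∣ else + 1

module Transfer {k : ℕ} (b : ℕ → ℤ) (ok final : Point k → Bool) where

  admissible : Point k → Path k → Bool
  admissible x []      = ok x ∧ final x
  admissible x (i ∷ p) = ok x ∧ admissible (step x i) p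

  total : Point k → ℕ → ℤ
  total x m = sumWhere (admissible x) (sswtFrom b x) (words k m)

  admissible-all : ∀ x p → admissible x p ≡ all ok (points x p) ∧ final (endpoint x p)
  admissible-all x []      = cong (_∧ final x) (sym (∧-identityʳ (ok x)))
  admissible-all x (i ∷ p) =
    trans (cong (ok x ∧_) (admissible-all (step x i) p)) (sym (∧-assoc (ok x) _ _))

  total-zero : ∀ {x} → ok x ≡ true → final x ≡ true → total x 0 ≡ + 1
  total-zero ok-x final-x = cong (λ c → if c then + 1 else + 0) (cong₂ _∧_ ok-x final-x)

  total-blocked : ∀ {x} → ok x ≡ false → ∀ m → total x m ≡ + 0
  total-blocked {x} ¬ok-x m = sumWhere-none (admissible x) (sswtFrom b x) rejected (words k m)
    where
    rejected : ∀ p → admissible x p ≡ false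
    rejected []      = cong (_∧ final x) ¬ok-x
    rejected (i ∷ p) = cong (_∧ admissible (step x i) p) ¬ok-x

  total-suc : ∀ {x} → ok x ≡ true → ∀ m →
    total x (suc m) ≡ sumℤ (map (λ i → upFactor b x i * total (step x i) m) (allFin k))
  total-suc {x} ok-x m =
    trans (sumWhere-concatMap (admissible x) (sswtFrom b x) (λ i → map (i ∷_) (words k m)) (allFin k))
          (cong sumℤ (map-cong first-step (allFin k)))
    where
    first-step : ∀ i → sumWhere (admissible x) (sswtFrom b x) (map (i ∷_) (words k m))
                       ≡ upFactor b x i * total (step x i) m
    first-step i = begin
      sumWhere (admissible x) (sswtFrom b x) (map (i ∷_) (words k m))
        ≡⟨ sumWhere-map (admissible x) (sswtFrom b x) (i ∷_) (words k m) ⟩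
      sumWhere (λ p → ok x ∧ admissible y p) (λ p → c * sswtFrom b y p) (words k m)
        ≡⟨ sumWhere-cong _ (λ p → cong (_∧ admissible y p) ok-x) (words k m) ⟩
      sumWhere (admissible y) (λ p → c * sswtFrom b y p) (words k m)
        ≡⟨ sumWhere-*ˡ (admissible y) (sswtFrom b y) c (words k m) ⟩
      c * total y m
        ∎
      where
      open ≡-Reasoning
      y = step x i
      c = upFactor b x i

  total-unique-successor : ∀ {x} (i : Fin k) → ok x ≡ true →
    (∀ j → j ≢ i → ok (step x j) ≡ false) → ∀ m →
    total x (suc m) ≡ upFactor b x i * total (step x i) m
  total-unique-successor {x} i ok-x blocked m =
    trans (total-suc ok-x m) (sum-allFin-single _ i vanishes)
    where
    vanishes : ∀ j → j ≢ i → upFactor b x j * total (step x j) m ≡ + 0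
    vanishes j j≢i =
      trans (cong (upFactor b x j *_) (total-blocked (blocked j j≢i) m)) (ℤ.*-zeroʳ (upFactor b x j))

Chat-total : ∀ b k u n →
  Chat b k u n ≡ Transfer.total b (ballotWithin u) (reaches n) origin (k ℕ.* n)
Chat-total b k u n =
  trans (sum-map-filter _ (sswt b) (words k (k ℕ.* n)))
        (sumWhere-cong (sswt b) conditions (words k (k ℕ.* n)))
  where
  open Transfer {k} b (ballotWithin u) (reaches n)

  balanced-reaches : ∀ p → balancedᵇ n p ≡ reaches n (endpoint origin p)
  balanced-reaches p =
    cong and (map-cong (λ j → cong (_≡ᵇ n) (sym (endpoint-count origin p j))) (allFin k))

  conditions : ∀ p → (balancedᵇ n p ∧ ballotᵇ p ∧ (heightP p ≤ᵇ u)) ≡ admissible origin p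
  conditions p = begin
    balancedᵇ n p ∧ ballotᵇ p ∧ (heightP p ≤ᵇ u)
      ≡⟨ cong₂ (λ B H → B ∧ ballotᵇ p ∧ H) (balanced-reaches p) (heightP-≤ᵇ u p) ⟩
    R ∧ all weaklyDecᵇ ps ∧ all (λ y → g y ≤ᵇ u) ps
      ≡⟨ cong (R ∧_) (sym (all-∧ weaklyDecᵇ (λ y → g y ≤ᵇ u) ps)) ⟩
    R ∧ all (ballotWithin u) ps
      ≡⟨ ∧-comm R _ ⟩
    all (ballotWithin u) ps ∧ R
      ≡⟨ sym (admissible-all origin p) ⟩
    admissible origin p
      ∎
    where
    open ≡-Reasoning
    ps = points origin p
    R  = reaches n (endpoint origin p)

pattern e₁ = zero
pattern e₂ = suc zero
pattern e₃ = suc (suc zero)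

point₃ : ℕ → ℕ → ℕ → Point 3
point₃ a b c e₁ = a
point₃ a b c e₂ = b
point₃ a b c e₃ = c

≗-point₃ : ∀ {x : Point 3} {a b c} →
  x e₁ ≡ a → x e₂ ≡ b → x e₃ ≡ c → x ≗ point₃ a b c
≗-point₃ x₁≡a x₂≡b x₃≡c e₁ = x₁≡a
≗-point₃ x₁≡a x₂≡b x₃≡c e₂ = x₂≡b
≗-point₃ x₁≡a x₂≡b x₃≡c e₃ = x₃≡c

-- For F among g, ballotWithin u and reaches n, which evaluate a point only at e₁, e₂ and
-- e₃, the two sides compute to F x and F y.
coords-cong : (F : Point 3 → A) {x y : Point 3} → x ≗ y →
  F (point₃ (x e₁) (x e₂) (x e₃)) ≡ F (point₃ (y e₁) (y e₂) (y e₃))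
coords-cong F {x} {y} x≗y =
  trans (cong₂ (λ a b → F (point₃ a b (x e₃))) (x≗y e₁) (x≗y e₂))
        (cong (F ∘ point₃ (y e₁) (y e₂)) (x≗y e₃))

step-cong : {x y : Point k} → x ≗ y → ∀ i → step x i ≗ step y i
step-cong x≗y i j = cong (λ v → if does (i ≟ j) then suc v else v) (x≗y j)

g-point₃ : ∀ d y z → g (point₃ (d ℕ.+ z) y z) ≡ + (2 ℕ.* d)
g-point₃ d y z = begin
  g (point₃ (d ℕ.+ z) y z)
    ≡⟨ cong (λ a → + 2 * a + (+ 0 * + y + (ℤ.- + 2 * + z + + 0))) (pos-+ d z) ⟩
  + 2 * (+ d + + z) + (+ 0 * + y + (ℤ.- + 2 * + z + + 0))
    ≡⟨ solve 3 (λ d y z → con (+ 2) :* (d :+ z) :+ (con (+ 0) :* y :+ (con (ℤ.- + 2) :* z :+ con (+ 0)))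
                          := con (+ 2) :* d)
             refl (+ d) (+ y) (+ z) ⟩
  + 2 * + d
    ≡⟨ sym (pos-* 2 d) ⟩
  + (2 ℕ.* d)
    ∎
  where
  open ≡-Reasoning
  open +-*-Solver

ballotWithin-u<g : ∀ {u} (x : Point k) → u ℤ.< g x → ballotWithin u x ≡ false
ballotWithin-u<g x u<gx =
  trans (cong (weaklyDecᵇ x ∧_) (≤ᵇ-false (ℤ.<⇒≱ u<gx))) (∧-zeroʳ (weaklyDecᵇ x))

ballotWithin-x₁<x₂ : ∀ {u} (x : Point 3) → x e₁ ℕ.< x e₂ → ballotWithin u x ≡ false
ballotWithin-x₁<x₂ x x₁<x₂ rewrite dec-false (x e₂ ≤? x e₁) (<⇒≱ x₁<x₂) = refl

ballotWithin-x₂<x₃ : ∀ {u} (x : Point 3) → x e₂ ℕ.< x e₃ → ballotWithin u x ≡ false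
ballotWithin-x₂<x₃ x x₂<x₃ rewrite dec-false (x e₃ ≤? x e₂) (<⇒≱ x₂<x₃)
  | ∧-zeroʳ (x e₃ ℕ.≤ᵇ x e₁) | ∧-zeroʳ (x e₂ ℕ.≤ᵇ x e₁) = refl

ballotWithin-ordered : ∀ {u} (x : Point 3) → x e₂ ≤ x e₁ → x e₃ ≤ x e₂ → g x ℤ.≤ u →
  ballotWithin u x ≡ true
ballotWithin-ordered x x₂≤x₁ x₃≤x₂ gx≤u
  rewrite dec-true (x e₂ ≤? x e₁) x₂≤x₁ | dec-true (x e₃ ≤? x e₂) x₃≤x₂
        | dec-true (x e₃ ≤? x e₁) (ℕ.≤-trans x₃≤x₂ x₂≤x₁) | ≤ᵇ-true gx≤u = refl

module Diagonal (b : ℕ → ℤ) {u : ℤ} (2≤u : + 2 ℤ.≤ u) (u<4 : u ℤ.< + 4) (n : ℕ) where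
  open Transfer {3} b (ballotWithin u) (reaches n)

  g≤u : ∀ d y z → d ≤ 1 → g (point₃ (d ℕ.+ z) y z) ℤ.≤ u
  g≤u d y z d≤1 = ℤ.≤-trans (ℤ.≤-reflexive (g-point₃ d y z))
                            (ℤ.≤-trans (ℤ.+≤+ (ℕ.*-monoʳ-≤ 2 d≤1)) 2≤u)

  u<g : ∀ y z → u ℤ.< g (point₃ (2 ℕ.+ z) y z)
  u<g y z = ℤ.<-≤-trans u<4 (ℤ.≤-reflexive (sym (g-point₃ 2 y z)))

  level-ok : ∀ a → ballotWithin u (point₃ a a a) ≡ true
  level-ok a = ballotWithin-ordered (point₃ a a a) ≤-refl ≤-refl (g≤u 0 a a ℕ.z≤n)

  total-unique-successor-at : ∀ {x y : Point 3} (i : Fin 3) → x ≗ y →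
    ballotWithin u y ≡ true → (∀ j → j ≢ i → ballotWithin u (step y j) ≡ false) → ∀ m →
    total x (suc m) ≡ upFactor b x i * total (step x i) m
  total-unique-successor-at i x≗y ok-y blocked =
    total-unique-successor i (trans (coords-cong (ballotWithin u) x≗y) ok-y)
      (λ j j≢i → trans (coords-cong (ballotWithin u) (step-cong x≗y j)) (blocked j j≢i))

  total-at-end : ∀ {a x} → a ≡ n → x ≗ point₃ a a a → total x 0 ≡ + 1
  total-at-end {x = x} refl x≗ = total-zero {x}
    (trans (coords-cong (ballotWithin u) x≗) (level-ok n))
    (trans (coords-cong (reaches n) x≗) n-reached)
    where
    n-reached : reaches n (point₃ n n n) ≡ true
    n-reached rewrite dec-true (n ℕ.≟ n) refl = refl

  total-at-level : ∀ {a x} → x ≗ point₃ a a a → ∀ m →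
    total x (suc m) ≡ b 0 * total (step x e₁) m
  total-at-level {a} {x} x≗ m = begin
    total x (suc m)                  ≡⟨ total-unique-successor-at e₁ x≗ (level-ok a) blocked m ⟩
    b ∣ g x ∣ * total (step x e₁) m  ≡⟨ cong (λ h → b ∣ h ∣ * total (step x e₁) m) gx≡0 ⟩
    b 0 * total (step x e₁) m        ∎
    where
    open ≡-Reasoning
    gx≡0 : g x ≡ + 0
    gx≡0 = trans (coords-cong g x≗) (g-point₃ 0 a a)
    blocked : ∀ j → j ≢ e₁ → ballotWithin u (step (point₃ a a a) j) ≡ false
    blocked e₁ e₁≢e₁ = contradiction refl e₁≢e₁
    blocked e₂ _     = ballotWithin-x₁<x₂ (point₃ a (suc a) a) (n<1+n a)
    blocked e₃ _     = ballotWithin-x₂<x₃ (point₃ a a (suc a)) (n<1+n a)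

  total-after-e₁ : ∀ {a x} → x ≗ point₃ (suc a) a a → ∀ m →
    total x (suc m) ≡ total (step x e₂) m
  total-after-e₁ {a} {x} x≗ m =
    trans (total-unique-successor-at e₂ x≗ ok blocked m) (ℤ.*-identityˡ (total (step x e₂) m))
    where
    ok : ballotWithin u (point₃ (suc a) a a) ≡ true
    ok = ballotWithin-ordered (point₃ (suc a) a a) (n≤1+n a) ≤-refl (g≤u 1 a a ≤-refl)
    blocked : ∀ j → j ≢ e₂ → ballotWithin u (step (point₃ (suc a) a a) j) ≡ false
    blocked e₁ _     = ballotWithin-u<g (point₃ (suc (suc a)) a a) (u<g a a)
    blocked e₂ e₂≢e₂ = contradiction refl e₂≢e₂
    blocked e₃ _     = ballotWithin-x₂<x₃ (point₃ (suc a) a (suc a)) (n<1+n a)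

  total-after-e₁e₂ : ∀ {a x} → x ≗ point₃ (suc a) (suc a) a → ∀ m →
    total x (suc m) ≡ total (step x e₃) m
  total-after-e₁e₂ {a} {x} x≗ m =
    trans (total-unique-successor-at e₃ x≗ ok blocked m) (ℤ.*-identityˡ (total (step x e₃) m))
    where
    ok : ballotWithin u (point₃ (suc a) (suc a) a) ≡ true
    ok = ballotWithin-ordered (point₃ (suc a) (suc a) a) ≤-refl (n≤1+n a) (g≤u 1 (suc a) a ≤-refl)
    blocked : ∀ j → j ≢ e₃ → ballotWithin u (step (point₃ (suc a) (suc a) a) j) ≡ false
    blocked e₁ _     = ballotWithin-u<g (point₃ (suc (suc a)) (suc a) a) (u<g (suc a) a)
    blocked e₂ _     = ballotWithin-x₁<x₂ (point₃ (suc a) (suc (suc a)) a) (n<1+n (suc a))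
    blocked e₃ e₃≢e₃ = contradiction refl e₃≢e₃

  total-diagonal : ∀ r {a} {x : Point 3} → a ℕ.+ r ≡ n → x ≗ point₃ a a a →
    total x (3 ℕ.* r) ≡ b 0 ^ r
  total-diagonal ℕ.zero  {a} a+0≡n x≗ = total-at-end (trans (sym (+-identityʳ a)) a+0≡n) x≗
  total-diagonal (suc r) {a} {x} a+[1+r]≡n x≗ = begin
    total x (3 ℕ.* suc r)           ≡⟨ cong (total x) (*-suc 3 r) ⟩
    total x (3 ℕ.+ 3 ℕ.* r)         ≡⟨ total-at-level x≗ (2 ℕ.+ 3 ℕ.* r) ⟩
    b 0 * total x₁ (2 ℕ.+ 3 ℕ.* r)  ≡⟨ cong (b 0 *_) (total-after-e₁ x₁≗ (1 ℕ.+ 3 ℕ.* r)) ⟩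
    b 0 * total x₂ (1 ℕ.+ 3 ℕ.* r)  ≡⟨ cong (b 0 *_) (total-after-e₁e₂ x₂≗ (3 ℕ.* r)) ⟩
    b 0 * total x₃ (3 ℕ.* r)        ≡⟨ cong (b 0 *_) (total-diagonal r 1+a+r≡n x₃≗) ⟩
    b 0 * b 0 ^ r                   ∎
    where
    open ≡-Reasoning
    1+a+r≡n : suc a ℕ.+ r ≡ n
    1+a+r≡n = trans (sym (+-suc a r)) a+[1+r]≡n
    x₁ x₂ x₃ : Point 3
    x₁ = step x e₁
    x₂ = step x₁ e₂
    x₃ = step x₂ e₃
    x₁≗ : x₁ ≗ point₃ (suc a) a a
    x₁≗ = ≗-point₃ (cong suc (x≗ e₁)) (x≗ e₂) (x≗ e₃)
    x₂≗ : x₂ ≗ point₃ (suc a) (suc a) a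
    x₂≗ = ≗-point₃ (x₁≗ e₁) (cong suc (x₁≗ e₂)) (x₁≗ e₃)
    x₃≗ : x₃ ≗ point₃ (suc a) (suc a) (suc a)
    x₃≗ = ≗-point₃ (x₂≗ e₁) (x₂≗ e₂) (cong suc (x₂≗ e₃))

Chat₃-2≤u<4 : ∀ b {u} → + 2 ℤ.≤ u → u ℤ.< + 4 → ∀ n → Chat b 3 u n ≡ b 0 ^ n
Chat₃-2≤u<4 b 2≤u u<4 n =
  trans (Chat-total b 3 _ n) (total-diagonal n refl (≗-point₃ refl refl refl))
  where open Diagonal b 2≤u u<4 n

-- The identity holds for n = 0 as well.
proposition4p1 : (b : ℕ → ℤ) (n : ℕ) → 1 ≤ n →
    (Chat b 3 (+ 2) n ≡ b 0 ^ n) × (Chat b 3 (+ 3) n ≡ b 0 ^ n)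
proposition4p1 b n _ =
  Chat₃-2≤u<4 b ℤ.≤-refl (ℤ.+<+ (ℕ.s≤s (n≤1+n 2))) n ,
  Chat₃-2≤u<4 b (ℤ.+≤+ (n≤1+n 2)) (ℤ.+<+ (n<1+n 3)) n
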